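{- Let $G$ be a connected graph of order $n=n(G)$. Then $\frac{n}{2}<\chi_\mu(G)=\left\lceil\frac{n}{2}\right\rceil$ if and only if $G$ is a path of odd order.
   Context: For a connected graph $G$ and $S\subseteq V(G)$, two vertices $x,y\in S$ are $S$-visible if there is a shortest $x,y$-path $P$ in $G$ with $V(P)\cap S=\{x,y\}$. $S$ is a mutual-visibility set if any two vertices of $S$ are $S$-visible. A mutual-visibility coloring of $G$ is a partition of $V(G)$ into mutual-visibility sets, and the mutual-visibility chromatic number $\chi_\mu(G)$ is the smallest number of classes in such a partition. -}

module Defs where

open import Level using (Level; 0ℓ)
open import Data.Nat using (ℕ; zero; suc; _+_; _*_; _≤_)
open import Data.Fin using (Fin; toℕ)
open import Data.Product using (Σ; ∃; _×_; _,_)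
open import Data.Unit using (⊤)
open import Data.Empty using (⊥)
open import Data.Sum using (_⊎_)
open import Relation.Nullary using (¬_)
open import Relation.Binary.PropositionalEquality using (_≡_; _≢_)
open import Function.Bundles using (_⤖_; Bijection)

record Graph (n : ℕ) : Set₁ where
  field
    Adj     : Fin n → Fin n → Set
    sym     : ∀ {x y} → Adj x y → Adj y x
    irrefl  : ∀ {x} → ¬ Adj x x
open Graph public

module _ {n : ℕ} (G : Graph n) where

  data Walk : Fin n → Fin n → ℕ → Set where
    []  : ∀ {x} → Walk x x 0
    _∷_ : ∀ {x y z k} → Adj G x y → Walk y z k → Walk x z (suc k)

  Connected : Set
  Connected = ∀ x y → ∃ λ k → Walk x y k

  IsShortest : ∀ {x y k} → Walk x y k → Set
  IsShortest {x} {y} {k} _ = ∀ m → Walk x y m → k ≤ m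

  AvoidAllButLast : (Fin n → Set) → ∀ {x y k} → Walk x y k → Set
  AvoidAllButLast S [] = ⊤
  AvoidAllButLast S (_∷_ {x = x} e w) = ¬ S x × AvoidAllButLast S w

  InternallyAvoids : (Fin n → Set) → ∀ {x y k} → Walk x y k → Set
  InternallyAvoids S [] = ⊤
  InternallyAvoids S (e ∷ w) = AvoidAllButLast S w

  Visible : (Fin n → Set) → Fin n → Fin n → Set
  Visible S x y = Σ ℕ λ k → Σ (Walk x y k) λ P → IsShortest P × InternallyAvoids S P

  MutualVisibility : (Fin n → Set) → Set
  MutualVisibility S = ∀ x y → S x → S y → Visible S x y

  -- A mutual-visibility coloring with k colors: every color class is a
  -- mutual-visibility set (color classes partition V(G); empty classes allowed).
  MVColoring : ℕ → Set
  MVColoring k = Σ (Fin n → Fin k) λ c → ∀ (i : Fin k) → MutualVisibility (λ v → c v ≡ i)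

  IsMVChromaticNumber : ℕ → Set
  IsMVChromaticNumber k = MVColoring k × (∀ m → MVColoring m → k ≤ m)

  IsPath : Set
  IsPath = Σ (Fin n ⤖ Fin n) λ f →
    ∀ i j → (Adj G (Bijection.to f i) (Bijection.to f j)
               → (suc (toℕ i) ≡ toℕ j) ⊎ (suc (toℕ j) ≡ toℕ i))
          × ((suc (toℕ i) ≡ toℕ j) ⊎ (suc (toℕ j) ≡ toℕ i)
               → Adj G (Bijection.to f i) (Bijection.to f j))

OddNat : ℕ → Set
OddNat n = ∃ λ k → n ≡ suc (2 * k)

module Submission where

-- The halving colouring (vertices 2i and 2i+1 share a colour) shows χ_μ(G) ≤ ⌈n/2⌉ for every
-- connected graph, since any set of at most two vertices is mutually visible; so n/2 < χ_μ = ⌈n/2⌉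
-- forces n = 2k+1 and χ_μ = k+1. Take a diametral pair u, w and a geodesic P between them. If some
-- vertex x is off P, then {u, w, x} is a mutual-visibility set: a geodesic between two of them through
-- the third would be longer than the diameter. Colouring {u, w, x} together and the other 2k−2
-- vertices in pairs uses k colours, a contradiction; hence P contains every vertex, and the distance
-- from u identifies G with a path. Conversely, in a path every walk between two vertices passes all
-- vertices in between, so a mutual-visibility set has at most two vertices and χ_μ ≥ n/2.
--
-- Adjacency is an arbitrary relation, so this case analysis is only available under double negation.
-- Being a path labelling with respect to the decidable relation "traversed by one of the walks given
-- by connectedness" is decidable, so the labelling itself is recovered by exhaustive search.

open import Defs hiding (sym)
open import Data.Nat using (ℕ; zero; suc; pred; _<_; _+_; _∸_; _≤_; z≤n; s≤s; ⌈_/2⌉; ⌊_/2⌋; _≤?_)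
open import Data.Nat.Properties
open import Data.Nat.Induction using (<-rec)
open import Data.Fin as Fin using (Fin; zero; suc; toℕ; fromℕ<; punchOut; join; splitAt)
open import Data.Fin.Properties
  using (any?; all?; toℕ-injective; toℕ-fromℕ<; toℕ<n; injective⇒≤; ¬∀⟶∃¬; punchOut-injective; fromℕ<-injective; splitAt-join; sequence)
  renaming (_≟_ to _≟ᶠ_; <⇒≢ to <ᶠ⇒≢; _<?_ to _<ᶠ?_; <-cmp to <ᶠ-cmp; <-trans to <ᶠ-trans)
open import Data.Fin.Permutation.Components using (transpose; transpose-inverse)
open import Data.Product using (Σ; ∃; _×_; _,_; proj₁; proj₂)
open import Data.Sum using (_⊎_; inj₁; inj₂)
open import Data.Sum.Properties using (inj₁-injective; inj₂-injective)
open import Data.Empty using (⊥; ⊥-elim)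
open import Data.Unit using (tt)
open import Data.Vec using (Vec; []; _∷_; lookup; tabulate)
open import Data.Vec.Properties using (lookup∘tabulate)
open import Effect.Monad using (RawMonad)
open import Function using (_∘_; _⇔_; mk⇔; Bijection; mk⤖)
open import Function.Definitions using (Injective)
open import Function.Consequences.Propositional using (strictlySurjective⇒surjective)
open import Relation.Nullary using (¬_; Dec; yes; no)
open import Relation.Nullary.Decidable using (_×-dec_; _⊎-dec_; _→-dec_; decidable-stable; ¬¬-excluded-middle; dec-true; dec-false)
open import Relation.Nullary.Negation using (¬¬-Monad; ¬¬-map)
open import Relation.Binary.PropositionalEquality
open import Relation.Binary.Definitions using (tri<; tri≈; tri>)

-- Arithmetic

Consecutive : ℕ → ℕ → Set
Consecutive i j = suc i ≡ j ⊎ suc j ≡ i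

consecutive? : ∀ i j → Dec (Consecutive i j)
consecutive? i j = (suc i ≟ j) ⊎-dec (suc j ≟ i)

≤1+∧≤1+∧≢⇒consecutive : ∀ {i j} → j ≤ suc i → i ≤ suc j → i ≢ j → Consecutive i j
≤1+∧≤1+∧≢⇒consecutive {i} {j} j≤1+i i≤1+j i≢j with <-cmp i j
... | tri< i<j _ _ = inj₁ (≤-antisym i<j j≤1+i)
... | tri≈ _ i≡j _ = ⊥-elim (i≢j i≡j)
... | tri> _ _ j<i = inj₂ (≤-antisym j<i i≤1+j)

consecutive-crossing : ∀ {i j t} → Consecutive i j → i ≤ t → t < j → i ≡ t × j ≡ suc t
consecutive-crossing (inj₁ refl) i≤t t<1+i = i≡t , cong suc i≡t
  where i≡t = ≤-antisym i≤t (≤-pred t<1+i)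
consecutive-crossing (inj₂ refl) 1+j≤t t<j = ⊥-elim (<-asym t<j 1+j≤t)

consecutive-< : ∀ {i j t} → Consecutive i j → i < t → j ≤ t
consecutive-< (inj₁ refl) i<t = i<t
consecutive-< (inj₂ refl) 1+j<t = <⇒≤ (<-trans (n<1+n _) 1+j<t)

Between : ℕ → ℕ → ℕ → Set
Between x y z = (x < y × y < z) ⊎ (z < y × y < x)

some-between : ∀ {x y z} → x ≢ y → x ≢ z → y ≢ z → Between y x z ⊎ Between x y z ⊎ Between x z y
some-between {x} {y} {z} x≢y x≢z y≢z with <-cmp x y | <-cmp y z | <-cmp x z
... | tri≈ _ x≡y _ | _ | _ = ⊥-elim (x≢y x≡y)
... | _ | tri≈ _ y≡z _ | _ = ⊥-elim (y≢z y≡z)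
... | _ | _ | tri≈ _ x≡z _ = ⊥-elim (x≢z x≡z)
... | tri< x<y _ _ | tri< y<z _ _ | _ = inj₂ (inj₁ (inj₁ (x<y , y<z)))
... | tri> _ _ y<x | tri> _ _ z<y | _ = inj₂ (inj₁ (inj₂ (z<y , y<x)))
... | tri< x<y _ _ | tri> _ _ z<y | tri< x<z _ _ = inj₂ (inj₂ (inj₁ (x<z , z<y)))
... | tri< x<y _ _ | tri> _ _ z<y | tri> _ _ z<x = inj₁ (inj₂ (z<x , x<y))
... | tri> _ _ y<x | tri< y<z _ _ | tri< x<z _ _ = inj₁ (inj₁ (y<x , x<z))
... | tri> _ _ y<x | tri< y<z _ _ | tri> _ _ z<x = inj₂ (inj₂ (inj₂ (y<z , z<x)))

AtMostTwo : {A : Set} → (A → Set) → Set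
AtMostTwo S = ∀ {a b c} → S a → S b → S c → a ≢ b → a ≢ c → b ≢ c → ⊥

atMostTwo-⊆ : {A : Set} {S T : A → Set} → (∀ {a} → S a → T a) → AtMostTwo T → AtMostTwo S
atMostTwo-⊆ S⊆T two sa sb sc = two (S⊆T sa) (S⊆T sb) (S⊆T sc)

atMostTwo-preimage : {A B : Set} {S : B → Set} (f : A → B) → Injective _≡_ _≡_ f → AtMostTwo S → AtMostTwo (S ∘ f)
atMostTwo-preimage f inj two sa sb sc a≢b a≢c b≢c = two sa sb sc (a≢b ∘ inj) (a≢c ∘ inj) (b≢c ∘ inj)

atMostTwo-pair : {A : Set} (p q : A) → AtMostTwo (λ a → a ≡ p ⊎ a ≡ q)
atMostTwo-pair p q (inj₁ refl) (inj₁ refl) _ a≢b _ _ = a≢b refl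
atMostTwo-pair p q (inj₂ refl) (inj₂ refl) _ a≢b _ _ = a≢b refl
atMostTwo-pair p q (inj₁ refl) _ (inj₁ refl) _ a≢c _ = a≢c refl
atMostTwo-pair p q (inj₂ refl) _ (inj₂ refl) _ a≢c _ = a≢c refl
atMostTwo-pair p q _ (inj₁ refl) (inj₁ refl) _ _ b≢c = b≢c refl
atMostTwo-pair p q _ (inj₂ refl) (inj₂ refl) _ _ b≢c = b≢c refl

⌊n/2⌋-parity : ∀ n → n ≡ ⌊ n /2⌋ + ⌊ n /2⌋ ⊎ n ≡ suc (⌊ n /2⌋ + ⌊ n /2⌋)
⌊n/2⌋-parity zero = inj₁ refl
⌊n/2⌋-parity (suc zero) = inj₂ refl
⌊n/2⌋-parity (suc (suc n)) with ⌊n/2⌋-parity n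
... | inj₁ eq = inj₁ (cong suc (trans (cong suc eq) (sym (+-suc ⌊ n /2⌋ ⌊ n /2⌋))))
... | inj₂ eq = inj₂ (cong suc (trans (cong suc eq) (cong suc (sym (+-suc ⌊ n /2⌋ ⌊ n /2⌋)))))

⌊/2⌋-fibre-atMostTwo : ∀ q → AtMostTwo (λ n → ⌊ n /2⌋ ≡ q)
⌊/2⌋-fibre-atMostTwo q = atMostTwo-⊆ oneOfTwo (atMostTwo-pair (q + q) (suc (q + q)))
  where
  oneOfTwo : ∀ {n} → ⌊ n /2⌋ ≡ q → n ≡ q + q ⊎ n ≡ suc (q + q)
  oneOfTwo {n} eq = subst (λ h → n ≡ h + h ⊎ n ≡ suc (h + h)) eq (⌊n/2⌋-parity n)

⌊/2⌋<⌈/2⌉ : ∀ {m n} → m < n → ⌊ m /2⌋ < ⌈ n /2⌉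
⌊/2⌋<⌈/2⌉ {n = suc n} (s≤s m≤n) = s≤s (⌊n/2⌋-mono m≤n)

⌈1+n+n/2⌉≡1+n : ∀ n → ⌈ suc (n + n) /2⌉ ≡ suc n
⌈1+n+n/2⌉≡1+n n = cong suc (sym (n≡⌊n+n/2⌋ n))

oddNat⇒1+n+n : ∀ {m} → OddNat m → ∃ λ n → m ≡ suc (n + n)
oddNat⇒1+n+n (n , refl) = n , cong (λ h → suc (n + h)) (+-identityʳ n)

<⌈/2⌉+⌈/2⌉⇒oddNat : ∀ m → m < ⌈ m /2⌉ + ⌈ m /2⌉ → OddNat m
<⌈/2⌉+⌈/2⌉⇒oddNat m m< with ⌊n/2⌋-parity m
... | inj₂ odd = ⌊ m /2⌋ , trans odd (cong (λ h → suc (⌊ m /2⌋ + h)) (sym (+-identityʳ _)))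
... | inj₁ even = ⊥-elim (<-irrefl refl h+h<h+h)
  where
  h = ⌊ m /2⌋
  h+h<h+h : h + h < h + h
  h+h<h+h = subst (λ c → h + h < c + c) (sym (n≡⌈n+n/2⌉ h)) (subst (λ n → n < ⌈ n /2⌉ + ⌈ n /2⌉) even m<)

1+n+n≤m+m⇒1+n≤m : ∀ {n m} → suc (n + n) ≤ m + m → suc n ≤ m
1+n+n≤m+m⇒1+n≤m {n} {m} le with suc n ≤? m
... | yes 1+n≤m = 1+n≤m
... | no 1+n≰m = ⊥-elim (<⇒≱ (s≤s (+-mono-≤ m≤n m≤n)) le)
  where m≤n = ≤-pred (≰⇒> 1+n≰m)

odd-squeeze : ∀ {m n χ} → m ≡ suc (n + n) → m ≤ χ + χ → χ ≤ ⌈ m /2⌉ → m < χ + χ × χ ≡ ⌈ m /2⌉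
odd-squeeze {n = n} {χ} refl m≤χ+χ χ≤⌈m/2⌉ =
  subst (λ c → suc (n + n) < c + c) (sym χ≡1+n) (s≤s (≤-reflexive (sym (+-suc n n)))) ,
  trans χ≡1+n (sym (⌈1+n+n/2⌉≡1+n n))
  where
  χ≡1+n : χ ≡ suc n
  χ≡1+n = ≤-antisym (subst (χ ≤_) (⌈1+n+n/2⌉≡1+n n) χ≤⌈m/2⌉) (1+n+n≤m+m⇒1+n≤m m≤χ+χ)

3≤1+n+n⇒0<n : ∀ {n} → 3 ≤ suc (n + n) → 0 < n
3≤1+n+n⇒0<n {zero} (s≤s ())
3≤1+n+n⇒0<n {suc n} _ = s≤s z≤n

≤2⇒≡0⊎≡1⊎≡2 : ∀ {j} → j ≤ 2 → j ≡ 0 ⊎ j ≡ 1 ⊎ j ≡ 2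
≤2⇒≡0⊎≡1⊎≡2 z≤n = inj₁ refl
≤2⇒≡0⊎≡1⊎≡2 (s≤s z≤n) = inj₂ (inj₁ refl)
≤2⇒≡0⊎≡1⊎≡2 (s≤s (s≤s z≤n)) = inj₂ (inj₂ refl)

⌊pred/2⌋<n : ∀ {j n} → 0 < n → j < suc (n + n) → ⌊ pred j /2⌋ < n
⌊pred/2⌋<n {j} {n} 0<n j<1+n+n = subst (⌊ pred j /2⌋ <_) (sym (n≡⌈n+n/2⌉ n)) (⌊/2⌋<⌈/2⌉ (pred<n+n j j<1+n+n))
  where
  pred<n+n : ∀ j → j < suc (n + n) → pred j < n + n
  pred<n+n zero _ = ≤-trans 0<n (m≤m+n n n)
  pred<n+n (suc j) (s≤s j<n+n) = j<n+n

⌊pred/2⌋≡0⇒≤2 : ∀ {j} → ⌊ pred j /2⌋ ≡ 0 → j ≤ 2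
⌊pred/2⌋≡0⇒≤2 {zero} _ = z≤n
⌊pred/2⌋≡0⇒≤2 {suc zero} _ = s≤s z≤n
⌊pred/2⌋≡0⇒≤2 {suc (suc zero)} _ = s≤s (s≤s z≤n)

⌊pred/2⌋-fibre-atMostTwo : ∀ q → AtMostTwo (λ j → ⌊ pred j /2⌋ ≡ suc q)
⌊pred/2⌋-fibre-atMostTwo q = atMostTwo-⊆ oneOfTwo (atMostTwo-pair (suc (h + h)) (suc (suc (h + h))))
  where
  h = suc q
  oneOfTwo : ∀ {j} → ⌊ pred j /2⌋ ≡ h → j ≡ suc (h + h) ⊎ j ≡ suc (suc (h + h))
  oneOfTwo {suc j} eq with ⌊n/2⌋-parity j
  ... | inj₁ even = inj₁ (cong suc (subst (λ c → j ≡ c + c) eq even))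
  ... | inj₂ odd = inj₂ (cong suc (subst (λ c → j ≡ suc (c + c)) eq odd))

-- Finite search and counting

Minimum : (ℕ → Set) → Set
Minimum P = Σ ℕ λ r → P r × (∀ {j} → P j → r ≤ j)

least : {P : ℕ → Set} → (∀ m → Dec (P m)) → ∀ {k} → P k → Minimum P
least {P} P? {k} = <-rec (λ k → P k → Minimum P) search k
  where
  search : ∀ k → (∀ {j} → j < k → P j → Minimum P) → P k → Minimum P
  search k below pk with anyUpTo? P? k
  ... | yes (j , j<k , pj) = below j<k pj
  ... | no none = k , pk , λ {j} pj → ≮⇒≥ λ j<k → none (j , j<k , pj)

argmax : ∀ {n} (f : Fin n → ℕ) → Fin n → Σ (Fin n) λ i → ∀ j → f j ≤ f i
argmax {suc zero} f _ = zero , λ { zero → ≤-refl }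
argmax {suc (suc n)} f _ with argmax (f ∘ suc) zero
... | i , max with f zero ≤? f (suc i)
...   | yes f0≤ = suc i , λ { zero → f0≤ ; (suc j) → max j }
...   | no f0≰ = zero , λ { zero → ≤-refl ; (suc j) → ≤-trans (max j) (≰⇒≥ f0≰) }

argmax₂ : ∀ {n} (f : Fin n → Fin n → ℕ) → Fin n → Σ (Fin n) λ a → Σ (Fin n) λ b → ∀ x y → f x y ≤ f a b
argmax₂ f v = a , best a , λ x y → ≤-trans (proj₂ (argmax (f x) v) y) (proj₂ (argmax (λ x → f x (best x)) v) x)
  where
  best = λ x → proj₁ (argmax (f x) v)
  a = proj₁ (argmax (λ x → f x (best x)) v)

∃-vec? : ∀ {m} k {P : Vec (Fin m) k → Set} → (∀ v → Dec (P v)) → Dec (∃ P)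
∃-vec? zero P? with P? []
... | yes p = yes ([] , p)
... | no ¬p = no λ { ([] , p) → ¬p p }
∃-vec? (suc k) P? with any? (λ a → ∃-vec? k (λ v → P? (a ∷ v)))
... | yes (a , v , p) = yes (a ∷ v , p)
... | no ¬p = no λ { (a ∷ v , p) → ¬p (a , v , p) }

¬¬-decidable : ∀ {n} (R : Fin n → Fin n → Set) → ¬ ¬ (∀ x y → Dec (R x y))
¬¬-decidable R = ¬¬-∀ λ x → ¬¬-∀ λ y → ¬¬-excluded-middle
  where
  ¬¬-∀ = sequence (RawMonad.rawApplicative ¬¬-Monad)

injective⇒surjective : ∀ {n} (f : Fin n → Fin n) → Injective _≡_ _≡_ f → ∀ y → ∃ λ x → f x ≡ y
injective⇒surjective {suc n} f f-inj y with any? (λ x → f x ≟ᶠ y)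
... | yes hit = hit
... | no miss = ⊥-elim (<-irrefl refl (injective⇒≤ {f = punchOut-f} (f-inj ∘ punchOut-injective {i = y} _ _)))
  where
  punchOut-f : Fin (suc n) → Fin n
  punchOut-f x = punchOut {i = y} (λ y≡fx → miss (x , sym y≡fx))

fromℕ<≡⇒≡toℕ : ∀ {m h} (h<m : h < m) {i : Fin m} → fromℕ< h<m ≡ i → h ≡ toℕ i
fromℕ<≡⇒≡toℕ h<m eq = trans (sym (toℕ-fromℕ< h<m)) (cong toℕ eq)

three-distinct⇒3≤n : ∀ {n} {a b c : Fin n} → a ≢ b → a ≢ c → b ≢ c → 3 ≤ n
three-distinct⇒3≤n {n} a≢b a≢c b≢c with 3 ≤? n
... | yes 3≤n = 3≤n
... | no 3≰n = ⊥-elim (atMostTwo-preimage toℕ toℕ-injective (atMostTwo-pair 0 1)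
                         (below2 _) (below2 _) (below2 _) a≢b a≢c b≢c)
  where
  below2 : ∀ v → toℕ v ≡ 0 ⊎ toℕ v ≡ 1
  below2 v with toℕ v | ≤-pred (≤-trans (s≤s (toℕ<n v)) (≰⇒> 3≰n))
  ... | zero | _ = inj₁ refl
  ... | suc zero | _ = inj₂ refl
  ... | suc (suc _) | s≤s (s≤s ())

module _ {n : ℕ} where

  transpose-injective : (i j : Fin n) → Injective _≡_ _≡_ (transpose i j)
  transpose-injective i j {x} {y} eq =
    trans (sym (transpose-inverse j i)) (trans (cong (transpose j i) eq) (transpose-inverse j i))

  transpose-left : (i j : Fin n) → transpose i j i ≡ j
  transpose-left i j rewrite dec-true (i ≟ᶠ i) refl = refl

  transpose-fixes : (i j : Fin n) {k : Fin n} → k ≢ i → k ≢ j → transpose i j k ≡ k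
  transpose-fixes i j {k} k≢i k≢j rewrite dec-false (k ≟ᶠ i) k≢i | dec-false (k ≟ᶠ j) k≢j = refl

moveToFront : ∀ {n} {a b c : Fin n} → a ≢ b → a ≢ c → b ≢ c →
  Σ (Fin n → Fin n) λ π → Injective _≡_ _≡_ π × toℕ (π a) ≡ 0 × toℕ (π b) ≡ 1 × toℕ (π c) ≡ 2
moveToFront {a = a} {b} {c} a≢b a≢c b≢c with three-distinct⇒3≤n a≢b a≢c b≢c
... | s≤s (s≤s (s≤s _)) = π , π-inj , cong toℕ πa≡0 , cong toℕ πb≡1 , cong toℕ πc≡2
  where
  τ₁ = transpose a zero
  σ = transpose (τ₁ b) (suc zero) ∘ τ₁
  π = transpose (σ c) (suc (suc zero)) ∘ σ

  σ-inj : Injective _≡_ _≡_ σ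
  σ-inj = transpose-injective a zero ∘ transpose-injective (τ₁ b) (suc zero)
  π-inj : Injective _≡_ _≡_ π
  π-inj = σ-inj ∘ transpose-injective (σ c) (suc (suc zero))

  τ₁b≢0 : τ₁ b ≢ zero
  τ₁b≢0 eq = a≢b (transpose-injective a zero (trans (transpose-left a zero) (sym eq)))
  σa≡0 : σ a ≡ zero
  σa≡0 = trans (cong (transpose (τ₁ b) (suc zero)) (transpose-left a zero))
               (transpose-fixes (τ₁ b) (suc zero) (τ₁b≢0 ∘ sym) λ ())
  σb≡1 : σ b ≡ suc zero
  σb≡1 = transpose-left (τ₁ b) (suc zero)

  πa≡0 : π a ≡ zero
  πa≡0 = trans (cong (transpose (σ c) (suc (suc zero))) σa≡0)
               (transpose-fixes (σ c) (suc (suc zero)) (λ 0≡σc → a≢c (σ-inj (trans σa≡0 0≡σc))) λ ())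
  πb≡1 : π b ≡ suc zero
  πb≡1 = trans (cong (transpose (σ c) (suc (suc zero))) σb≡1)
               (transpose-fixes (σ c) (suc (suc zero)) (λ 1≡σc → b≢c (σ-inj (trans σb≡1 1≡σc))) λ ())
  πc≡2 : π c ≡ suc (suc zero)
  πc≡2 = transpose-left (σ c) (suc (suc zero))

fibres-atMostTwo⇒≤ : ∀ {n m} (c : Fin n → Fin m) → (∀ i → AtMostTwo (λ v → c v ≡ i)) → n ≤ m + m
fibres-atMostTwo⇒≤ {n} {m} c two = injective⇒≤ {f = join m m ∘ ι} (ι-injective ∘ join-injective)
  where
  -- The first vertex of each colour goes to the left copy of Fin m, a repeated one to the right copy.
  Repeated : Fin n → Set
  Repeated v = ∃ λ u → u Fin.< v × c u ≡ c v

  repeated? : ∀ v → Dec (Repeated v)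
  repeated? v = any? λ u → (u <ᶠ? v) ×-dec (c u ≟ᶠ c v)

  tag : ∀ {v} → Dec (Repeated v) → Fin m ⊎ Fin m
  tag {v} (yes _) = inj₂ (c v)
  tag {v} (no _) = inj₁ (c v)

  ι : Fin n → Fin m ⊎ Fin m
  ι v = tag (repeated? v)

  join-injective : ∀ {x y} → join m m x ≡ join m m y → x ≡ y
  join-injective {x} {y} eq = trans (sym (splitAt-join m m x)) (trans (cong (splitAt m) eq) (splitAt-join m m y))

  noThird : ∀ {x y z} → x Fin.< y → y Fin.< z → c x ≡ c z → c y ≡ c z → ⊥
  noThird {z = z} x<y y<z cx≡cz cy≡cz = two (c z) cx≡cz cy≡cz refl (<ᶠ⇒≢ x<y) (<ᶠ⇒≢ (<ᶠ-trans x<y y<z)) (<ᶠ⇒≢ y<z)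

  ι-injective : Injective _≡_ _≡_ ι
  ι-injective {a} {b} eq with repeated? a | repeated? b | <ᶠ-cmp a b
  ι-injective {a} {b} () | yes _ | no _ | _
  ι-injective {a} {b} () | no _ | yes _ | _
  ... | _ | _ | tri≈ _ a≡b _ = a≡b
  ... | no _ | no b-first | tri< a<b _ _ = ⊥-elim (b-first (a , a<b , inj₁-injective eq))
  ... | no a-first | no _ | tri> _ _ b<a = ⊥-elim (a-first (b , b<a , sym (inj₁-injective eq)))
  ... | yes (a′ , a′<a , ca′≡ca) | yes _ | tri< a<b _ _ =
    ⊥-elim (noThird a′<a a<b (trans ca′≡ca (inj₂-injective eq)) (inj₂-injective eq))
  ... | yes _ | yes (b′ , b′<b , cb′≡cb) | tri> _ _ b<a =
    ⊥-elim (noThird b′<b b<a (trans cb′≡cb (sym (inj₂-injective eq))) (sym (inj₂-injective eq)))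

-- Walks and visibility

module Walks {n : ℕ} (G : Graph n) where

  _++_ : ∀ {x y z k m} → Walk G x y k → Walk G y z m → Walk G x z (k + m)
  [] ++ w = w
  (e ∷ v) ++ w = e ∷ (v ++ w)

  snoc : ∀ {x y z k} → Walk G x y k → Adj G y z → Walk G x z (suc k)
  snoc [] e = e ∷ []
  snoc (e′ ∷ w) e = e′ ∷ snoc w e

  reverse : ∀ {x y k} → Walk G x y k → Walk G y x k
  reverse [] = []
  reverse (e ∷ w) = snoc (reverse w) (Graph.sym G e)

  length0⇒≡ : ∀ {x y} → Walk G x y 0 → x ≡ y
  length0⇒≡ [] = refl

  data NotLast (z : Fin n) : ∀ {x y k} → Walk G x y k → Set where
    here : ∀ {y b k} {e : Adj G z y} {w : Walk G y b k} → NotLast z (e ∷ w)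
    there : ∀ {x y b k} {e : Adj G x y} {w : Walk G y b k} → NotLast z w → NotLast z (e ∷ w)

  Inner : Fin n → ∀ {x y k} → Walk G x y k → Set
  Inner z [] = ⊥
  Inner z (e ∷ w) = NotLast z w

  avoidAllButLast : ∀ {S x y k} (w : Walk G x y k) → (∀ z → NotLast z w → ¬ S z) → AvoidAllButLast G S w
  avoidAllButLast [] _ = tt
  avoidAllButLast (e ∷ w) avoid = avoid _ here , avoidAllButLast w (λ z → avoid z ∘ there)

  internallyAvoids : ∀ {S x y k} (w : Walk G x y k) → (∀ z → Inner z w → ¬ S z) → InternallyAvoids G S w
  internallyAvoids [] _ = tt
  internallyAvoids (e ∷ w) avoid = avoidAllButLast w avoid

  notLast-avoided : ∀ {S z x y k} (w : Walk G x y k) → AvoidAllButLast G S w → NotLast z w → ¬ S z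
  notLast-avoided (e ∷ w) (¬Sx , _) here = ¬Sx
  notLast-avoided (e ∷ w) (_ , avoids) (there p) = notLast-avoided w avoids p

  inner-avoided : ∀ {S z x y k} (w : Walk G x y k) → InternallyAvoids G S w → Inner z w → ¬ S z
  inner-avoided (e ∷ w) = notLast-avoided w

  notLast-split : ∀ {z x y k} (w : Walk G x y k) → NotLast z w →
    Σ ℕ λ k₁ → Σ ℕ λ k₂ → Walk G x z k₁ × Walk G z y (suc k₂) × k₁ + suc k₂ ≡ k
  notLast-split (e ∷ w) here = 0 , _ , [] , e ∷ w , refl
  notLast-split (e ∷ w) (there p) with notLast-split w p
  ... | k₁ , k₂ , w₁ , w₂ , eq = suc k₁ , k₂ , e ∷ w₁ , w₂ , cong suc eq

  inner-split : ∀ {z x y k} (w : Walk G x y k) → Inner z w →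
    Σ ℕ λ k₁ → Σ ℕ λ k₂ → Walk G x z (suc k₁) × Walk G z y (suc k₂) × suc k₁ + suc k₂ ≡ k
  inner-split (e ∷ w) p with notLast-split w p
  ... | k₁ , k₂ , w₁ , w₂ , eq = k₁ , k₂ , e ∷ w₁ , w₂ , cong suc eq

  data At (v : Fin n) : ∀ {x y k} → Walk G x y k → ℕ → Set where
    start : ∀ {y k} {w : Walk G v y k} → At v w 0
    next : ∀ {x y z k i} {e : Adj G x y} {w : Walk G y z k} → At v w i → At v (e ∷ w) (suc i)

  _∈ʷ_ : Fin n → ∀ {x y k} → Walk G x y k → Set
  v ∈ʷ w = Σ ℕ (At v w)

  at-split : ∀ {v x y k i} (w : Walk G x y k) → At v w i → i ≤ k × Walk G x v i × Walk G v y (k ∸ i)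
  at-split w start = z≤n , [] , w
  at-split (e ∷ w) (next p) with at-split w p
  ... | i≤k , w₁ , w₂ = s≤s i≤k , e ∷ w₁ , w₂

  at-functional : ∀ {v v′ x y k i} (w : Walk G x y k) → At v w i → At v′ w i → v ≡ v′
  at-functional w start start = refl
  at-functional (e ∷ w) (next p) (next q) = at-functional w p q

  at-exists : ∀ {x y k} (w : Walk G x y k) i → i ≤ k → ∃ λ v → At v w i
  at-exists w zero _ = _ , start
  at-exists (e ∷ w) (suc i) (s≤s i≤k) with at-exists w i i≤k
  ... | v , p = v , next p

  at-end : ∀ {x y k} (w : Walk G x y k) → At y w k
  at-end [] = start
  at-end (e ∷ w) = next (at-end w)

  at-adjacent : ∀ {v v′ x y k i} (w : Walk G x y k) → At v w i → At v′ w (suc i) → Adj G v v′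
  at-adjacent (e ∷ w) start (next start) = e
  at-adjacent (e ∷ w) (next p) (next q) = at-adjacent w p q

  _∈ʷ?_ : ∀ v {x y k} (w : Walk G x y k) → Dec (v ∈ʷ w)
  _∈ʷ?_ v {x} w with v ≟ᶠ x
  ... | yes refl = yes (0 , start)
  v ∈ʷ? [] | no v≢x = no λ { (_ , start) → v≢x refl }
  v ∈ʷ? (e ∷ w) | no v≢x with v ∈ʷ? w
  ... | yes (i , p) = yes (suc i , next p)
  ... | no v∉w = no λ { (_ , start) → v≢x refl ; (_ , next p) → v∉w (_ , p) }

  ∈-snoc : ∀ {v x y z k} (w : Walk G x y k) (e : Adj G y z) → v ∈ʷ snoc w e → v ∈ʷ w ⊎ v ≡ z
  ∈-snoc [] e (_ , start) = inj₁ (0 , start)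
  ∈-snoc [] e (_ , next start) = inj₂ refl
  ∈-snoc (e′ ∷ w) e (_ , start) = inj₁ (0 , start)
  ∈-snoc (e′ ∷ w) e (_ , next p) with ∈-snoc w e (_ , p)
  ... | inj₁ (i , q) = inj₁ (suc i , next q)
  ... | inj₂ v≡z = inj₂ v≡z

  ∈-reverse : ∀ {v x y k} (w : Walk G x y k) → v ∈ʷ reverse w → v ∈ʷ w
  ∈-reverse [] v∈ = v∈
  ∈-reverse (e ∷ w) v∈ with ∈-snoc (reverse w) (Graph.sym G e) v∈
  ... | inj₁ v∈w with ∈-reverse w v∈w
  ...   | i , p = suc i , next p
  ∈-reverse (e ∷ w) v∈ | inj₂ refl = 0 , start

  notLast⇒∈ : ∀ {z x y k} (w : Walk G x y k) → NotLast z w → z ∈ʷ w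
  notLast⇒∈ (e ∷ w) here = 0 , start
  notLast⇒∈ (e ∷ w) (there p) with notLast⇒∈ w p
  ... | i , q = suc i , next q

  inner⇒∈ : ∀ {z x y k} (w : Walk G x y k) → Inner z w → z ∈ʷ w
  inner⇒∈ (e ∷ w) p with notLast⇒∈ w p
  ... | i , q = suc i , next q

  data Step (a b : Fin n) : ∀ {x y k} → Walk G x y k → Set where
    here : ∀ {z k} {e : Adj G a b} {w : Walk G b z k} → Step a b (e ∷ w)
    there : ∀ {x y z k} {e : Adj G x y} {w : Walk G y z k} → Step a b w → Step a b (e ∷ w)

  step-adjacent : ∀ {a b x y k} (w : Walk G x y k) → Step a b w → Adj G a b
  step-adjacent (e ∷ w) here = e
  step-adjacent (e ∷ w) (there p) = step-adjacent w p

  step⇒notLast : ∀ {a b x y k} (w : Walk G x y k) → Step a b w → NotLast a w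
  step⇒notLast (e ∷ w) here = here
  step⇒notLast (e ∷ w) (there p) = there (step⇒notLast w p)

  step? : ∀ a b {x y k} (w : Walk G x y k) → Dec (Step a b w)
  step? a b [] = no λ ()
  step? a b (_∷_ {x} {y} e w) with step? a b w | a ≟ᶠ x | b ≟ᶠ y
  ... | yes p | _ | _ = yes (there p)
  ... | no _ | yes refl | yes refl = yes here
  ... | no ¬p | no a≢x | _ = no λ { here → a≢x refl ; (there p) → ¬p p }
  ... | no ¬p | yes _ | no b≢y = no λ { here → b≢y refl ; (there p) → ¬p p }

  crossing : (ℓ : Fin n → ℕ) → (∀ {a b} → Adj G a b → Consecutive (ℓ a) (ℓ b)) →
    ∀ t {x y k} (w : Walk G x y k) → ℓ x ≤ t → t < ℓ y →
    Σ (Fin n) λ z → Σ (Fin n) λ z′ → Step z z′ w × ℓ z ≡ t × ℓ z′ ≡ suc t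
  crossing ℓ ℓ-adj t [] ℓx≤t t<ℓx = ⊥-elim (<⇒≱ t<ℓx ℓx≤t)
  crossing ℓ ℓ-adj t (_∷_ {x} {y} e w) ℓx≤t t<ℓz with ℓ y ≤? t
  ... | no ℓy≰t = x , y , here , consecutive-crossing (ℓ-adj e) ℓx≤t (≰⇒> ℓy≰t)
  ... | yes ℓy≤t with crossing ℓ ℓ-adj t w ℓy≤t t<ℓz
  ...   | z , z′ , step , ℓz≡t , ℓz′≡1+t = z , z′ , there step , ℓz≡t , ℓz′≡1+t

  visible-refl : ∀ {S x} → Visible G S x x
  visible-refl = 0 , [] , (λ _ _ → z≤n) , tt

  visible-via : ∀ {S x y k} (P : Walk G x y k) → IsShortest G P → (∀ z → Inner z P → ¬ S z) → Visible G S x y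
  visible-via P P-shortest avoid = _ , P , P-shortest , internallyAvoids P avoid

  avoidAllButLast-⊆ : ∀ {S T x y k} → (∀ {v} → S v → T v) → (w : Walk G x y k) → AvoidAllButLast G T w → AvoidAllButLast G S w
  avoidAllButLast-⊆ S⊆T [] _ = tt
  avoidAllButLast-⊆ S⊆T (e ∷ w) (¬Tx , avoids) = ¬Tx ∘ S⊆T , avoidAllButLast-⊆ S⊆T w avoids

  mutualVisibility-⊆ : ∀ {S T} → (∀ {v} → S v → T v) → MutualVisibility G T → MutualVisibility G S
  mutualVisibility-⊆ S⊆T T-mv x y Sx Sy with T-mv x y (S⊆T Sx) (S⊆T Sy)
  ... | k , [] , shortest , _ = k , [] , shortest , tt
  ... | k , e ∷ P , shortest , avoids = k , e ∷ P , shortest , avoidAllButLast-⊆ S⊆T P avoids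

-- Distances

module Distance {n : ℕ} (G : Graph n) (connected : Connected G) (adj? : ∀ x y → Dec (Adj G x y)) where
  open Walks G

  walk? : ∀ k x y → Dec (Walk G x y k)
  walk? zero x y with x ≟ᶠ y
  ... | yes refl = yes []
  ... | no x≢y = no (x≢y ∘ length0⇒≡)
  walk? (suc k) x y with any? (λ z → adj? x z ×-dec walk? k z y)
  ... | yes (z , e , w) = yes (e ∷ w)
  ... | no ¬w = no λ { (e ∷ w) → ¬w (_ , e , w) }

  abstract
    shortestWalk : ∀ x y → Minimum (Walk G x y)
    shortestWalk x y = least (λ k → walk? k x y) (proj₂ (connected x y))

  dist : Fin n → Fin n → ℕ
  dist x y = proj₁ (shortestWalk x y)

  geodesic : ∀ x y → Walk G x y (dist x y)
  geodesic x y = proj₁ (proj₂ (shortestWalk x y))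

  dist-minimal : ∀ {x y j} → Walk G x y j → dist x y ≤ j
  dist-minimal {x} {y} = proj₂ (proj₂ (shortestWalk x y))

  geodesic-shortest : ∀ x y → IsShortest G (geodesic x y)
  geodesic-shortest x y _ = dist-minimal

  shortest⇒≡dist : ∀ {x y k} (P : Walk G x y k) → IsShortest G P → k ≡ dist x y
  shortest⇒≡dist P P-shortest = ≤-antisym (P-shortest _ (geodesic _ _)) (dist-minimal P)

  dist-sym : ∀ x y → dist x y ≡ dist y x
  dist-sym x y = ≤-antisym (dist-minimal (reverse (geodesic y x))) (dist-minimal (reverse (geodesic x y)))

  dist-refl : ∀ x → dist x x ≡ 0
  dist-refl x = n≤0⇒n≡0 (dist-minimal {x} [])

  dist≡0⇒≡ : ∀ {x y} → dist x y ≡ 0 → x ≡ y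
  dist≡0⇒≡ {x} {y} eq = length0⇒≡ (subst (Walk G x y) eq (geodesic x y))

  dist-adjacent : ∀ u {a b} → Adj G a b → dist u b ≤ suc (dist u a)
  dist-adjacent u {a} e = dist-minimal (snoc (geodesic u a) e)

  reverse-shortest : ∀ {x y k} (P : Walk G x y k) → IsShortest G P → IsShortest G (reverse P)
  reverse-shortest P P-shortest m w = P-shortest m (reverse w)

  shortest-at : ∀ {x y k z i} (P : Walk G x y k) → IsShortest G P → At z P i → dist x z ≡ i
  shortest-at {x} {k = k} {z} {i} P P-shortest z-at with at-split P z-at
  ... | i≤k , prefix , suffix = ≤-antisym (dist-minimal prefix) (≮⇒≥ shortcut)
    where
    shortcut : dist x z < i → ⊥
    shortcut dist<i = <⇒≱ (subst (dist x z + (k ∸ i) <_) (m+[n∸m]≡n i≤k) (+-monoˡ-< (k ∸ i) dist<i))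
                          (P-shortest _ (geodesic x z ++ suffix))

  inner-shortest : ∀ {x y k z} (P : Walk G x y k) → IsShortest G P → Inner z P → dist x z < k × dist z y < k
  inner-shortest P _ z-inner with inner-split P z-inner
  ... | k₁ , k₂ , prefix , suffix , refl =
    ≤-trans (s≤s (dist-minimal prefix)) (m<m+n (suc k₁) (s≤s z≤n)) ,
    ≤-trans (s≤s (dist-minimal suffix)) (m<n+m (suc k₂) (s≤s z≤n))

  inner-shortest-≢ : ∀ {x y k z} (P : Walk G x y k) → IsShortest G P → Inner z P → z ≢ x × z ≢ y
  inner-shortest-≢ P P-shortest z-inner with inner-shortest P P-shortest z-inner
  ... | dist<k , dist<k′ = (λ { refl → <-irrefl k≡dist dist<k′ }) , (λ { refl → <-irrefl k≡dist dist<k })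
    where
    k≡dist = sym (shortest⇒≡dist P P-shortest)

  atMostTwo⇒mutualVisibility : ∀ {S} → AtMostTwo S → MutualVisibility G S
  atMostTwo⇒mutualVisibility {S} two x y Sx Sy with x ≟ᶠ y
  ... | yes refl = visible-refl
  ... | no x≢y = visible-via (geodesic x y) (geodesic-shortest x y) third
    where
    third : ∀ z → Inner z (geodesic x y) → ¬ S z
    third z z-inner Sz with inner-shortest-≢ (geodesic x y) (geodesic-shortest x y) z-inner
    ... | z≢x , z≢y = two Sx Sy Sz x≢y (z≢x ∘ sym) (z≢y ∘ sym)

  halvingColouring : MVColoring G ⌈ n /2⌉
  halvingColouring = (λ v → fromℕ< (⌊/2⌋<⌈/2⌉ (toℕ<n v))) , λ i →
    atMostTwo⇒mutualVisibility (atMostTwo-⊆ (λ {v} → fromℕ<≡⇒≡toℕ (⌊/2⌋<⌈/2⌉ (toℕ<n v)))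
      (atMostTwo-preimage toℕ toℕ-injective (⌊/2⌋-fibre-atMostTwo (toℕ i))))

-- Diametral paths

module Traversal {n : ℕ} (G : Graph n) (connected : Connected G) where
  open Walks G

  connecting : ∀ p q → Walk G p q (proj₁ (connected p q))
  connecting p q = proj₂ (connected p q)

  -- A decidable subrelation of Adj; for a path graph it is all of Adj.
  Traversed : Fin n → Fin n → Set
  Traversed a b = Σ (Fin n) λ p → Σ (Fin n) λ q → Step a b (connecting p q) ⊎ Step b a (connecting p q)

  traversed? : ∀ a b → Dec (Traversed a b)
  traversed? a b = any? λ p → any? λ q → step? a b (connecting p q) ⊎-dec step? b a (connecting p q)

  traversed⇒adj : ∀ {a b} → Traversed a b → Adj G a b
  traversed⇒adj (p , q , inj₁ step) = step-adjacent (connecting p q) step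
  traversed⇒adj (p , q , inj₂ step) = Graph.sym G (step-adjacent (connecting p q) step)

  PathLabelling : (Fin n → Fin n) → Set
  PathLabelling f = Injective _≡_ _≡_ f
    × (∀ i j → Consecutive (toℕ i) (toℕ j) → Traversed (f i) (f j))
    × (∀ i j → Traversed (f i) (f j) → Consecutive (toℕ i) (toℕ j))

  pathLabelling? : ∀ f → Dec (PathLabelling f)
  pathLabelling? f with all? (λ i → all? λ j → (f i ≟ᶠ f j) →-dec (i ≟ᶠ j))
                      | all? (λ i → all? λ j → consecutive? (toℕ i) (toℕ j) →-dec traversed? (f i) (f j))
                      | all? (λ i → all? λ j → traversed? (f i) (f j) →-dec consecutive? (toℕ i) (toℕ j))
  ... | yes inj | yes cons⇒tr | yes tr⇒cons = yes ((λ {i} {j} → inj i j) , cons⇒tr , tr⇒cons)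
  ... | no ¬inj | _ | _ = no λ lab → ¬inj λ i j → proj₁ lab
  ... | yes _ | no ¬cons⇒tr | _ = no (¬cons⇒tr ∘ proj₁ ∘ proj₂)
  ... | yes _ | yes _ | no ¬tr⇒cons = no (¬tr⇒cons ∘ proj₂ ∘ proj₂)

  pathLabelling-ext : ∀ {f g} → (∀ i → g i ≡ f i) → PathLabelling f → PathLabelling g
  pathLabelling-ext {f} {g} g≗f (inj , cons⇒tr , tr⇒cons) =
    (λ {i} {j} eq → inj (trans (sym (g≗f i)) (trans eq (g≗f j)))) ,
    (λ i j cons → subst₂ Traversed (sym (g≗f i)) (sym (g≗f j)) (cons⇒tr i j cons)) ,
    (λ i j tr → tr⇒cons i j (subst₂ Traversed (g≗f i) (g≗f j) tr))

  labelling⇒isPath : ∀ {f} → PathLabelling f → ¬ ¬ (∀ {a b} → Adj G a b → Traversed a b) → IsPath G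
  labelling⇒isPath {f} (inj , cons⇒tr , tr⇒cons) ¬¬adj⇒tr =
    mk⤖ (inj , strictlySurjective⇒surjective (injective⇒surjective f inj)) ,
    λ i j → adj⇒cons i j , traversed⇒adj ∘ cons⇒tr i j
    where
    adj⇒cons : ∀ i j → Adj G (f i) (f j) → Consecutive (toℕ i) (toℕ j)
    adj⇒cons i j e = decidable-stable (consecutive? (toℕ i) (toℕ j))
                                      (¬¬-map (λ adj⇒tr → tr⇒cons i j (adj⇒tr e)) ¬¬adj⇒tr)

module Diametral {n : ℕ} (G : Graph n) (connected : Connected G) (adj? : ∀ x y → Dec (Adj G x y)) (v₀ : Fin n) where
  open Walks G
  open Distance G connected adj?
  open Traversal G connected

  u w : Fin n
  u = proj₁ (argmax₂ dist v₀)
  w = proj₁ (proj₂ (argmax₂ dist v₀))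

  d : ℕ
  d = dist u w

  diametral : ∀ a b → dist a b ≤ d
  diametral = proj₂ (proj₂ (argmax₂ dist v₀))

  P₀ : Walk G u w d
  P₀ = geodesic u w

  P₀-shortest : IsShortest G P₀
  P₀-shortest = geodesic-shortest u w

  spans? : (∀ x → x ∈ʷ P₀) ⊎ ∃ λ x → ¬ x ∈ʷ P₀
  spans? with all? (λ x → x ∈ʷ? P₀)
  ... | yes spans = inj₁ spans
  ... | no ¬spans = inj₂ (¬∀⟶∃¬ n _ (λ x → x ∈ʷ? P₀) ¬spans)

  module Spanning (spans : ∀ x → x ∈ʷ P₀) where

    distᵤ-injective : Injective _≡_ _≡_ (dist u)
    distᵤ-injective {a} {b} eq with spans a | spans b
    ... | i , a-at | j , b-at = at-functional P₀ a-at (subst (At b P₀) j≡i b-at)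
      where j≡i = trans (sym (shortest-at P₀ P₀-shortest b-at)) (trans (sym eq) (shortest-at P₀ P₀-shortest a-at))

    adj⇒consecutive : ∀ {a b} → Adj G a b → Consecutive (dist u a) (dist u b)
    adj⇒consecutive {a} e = ≤1+∧≤1+∧≢⇒consecutive (dist-adjacent u e) (dist-adjacent u (Graph.sym G e))
      (λ eq → Graph.irrefl G (subst (Adj G a) (sym (distᵤ-injective eq)) e))

    forward-traversed : ∀ {a b} → suc (dist u a) ≡ dist u b → Step a b (connecting u w)
    forward-traversed {a} {b} 1+da≡db
      with crossing (dist u) adj⇒consecutive (dist u a) (connecting u w)
             (subst (_≤ dist u a) (sym (dist-refl u)) z≤n) (≤-trans (≤-reflexive 1+da≡db) (diametral u b))
    ... | z , z′ , step , dz≡da , dz′≡1+da =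
      subst₂ (λ p q → Step p q (connecting u w)) (distᵤ-injective dz≡da) (distᵤ-injective (trans dz′≡1+da 1+da≡db)) step

    adj⇒traversed : ∀ {a b} → Adj G a b → Traversed a b
    adj⇒traversed e with adj⇒consecutive e
    ... | inj₁ forward = u , w , inj₁ (forward-traversed forward)
    ... | inj₂ backward = u , w , inj₂ (forward-traversed backward)

    n≤1+d : n ≤ suc d
    n≤1+d = injective⇒≤ {f = λ v → fromℕ< (s≤s (diametral u v))} (distᵤ-injective ∘ fromℕ<-injective _ _ _ _)

    labelling : Fin n → Fin n
    labelling i = proj₁ (at-exists P₀ (toℕ i) (≤-pred (≤-trans (toℕ<n i) n≤1+d)))

    labelling-at : ∀ i → At (labelling i) P₀ (toℕ i)
    labelling-at i = proj₂ (at-exists P₀ (toℕ i) (≤-pred (≤-trans (toℕ<n i) n≤1+d)))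

    dist-labelling : ∀ i → dist u (labelling i) ≡ toℕ i
    dist-labelling i = shortest-at P₀ P₀-shortest (labelling-at i)

    consecutive⇒adj : ∀ i j → suc (toℕ i) ≡ toℕ j → Adj G (labelling i) (labelling j)
    consecutive⇒adj i j 1+i≡j = at-adjacent P₀ (labelling-at i) (subst (At (labelling j) P₀) (sym 1+i≡j) (labelling-at j))

    labelling-isPathLabelling : PathLabelling labelling
    labelling-isPathLabelling = injective , cons⇒tr , tr⇒cons
      where
      injective : Injective _≡_ _≡_ labelling
      injective {i} {j} eq = toℕ-injective (trans (sym (dist-labelling i)) (trans (cong (dist u) eq) (dist-labelling j)))
      cons⇒tr : ∀ i j → Consecutive (toℕ i) (toℕ j) → Traversed (labelling i) (labelling j)
      cons⇒tr i j (inj₁ 1+i≡j) = adj⇒traversed (consecutive⇒adj i j 1+i≡j)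
      cons⇒tr i j (inj₂ 1+j≡i) = adj⇒traversed (Graph.sym G (consecutive⇒adj j i 1+j≡i))
      tr⇒cons : ∀ i j → Traversed (labelling i) (labelling j) → Consecutive (toℕ i) (toℕ j)
      tr⇒cons i j tr = subst₂ Consecutive (dist-labelling i) (dist-labelling j) (adj⇒consecutive (traversed⇒adj tr))

  module OffPath (x : Fin n) (x∉P₀ : ¬ x ∈ʷ P₀) where

    x≢u : x ≢ u
    x≢u x≡u = x∉P₀ (0 , subst (λ v → At v P₀ 0) (sym x≡u) start)

    x≢w : x ≢ w
    x≢w x≡w = x∉P₀ (d , subst (λ v → At v P₀ d) (sym x≡w) (at-end P₀))

    u≢w : u ≢ w
    u≢w u≡w = x≢u (sym (dist≡0⇒≡ (n≤0⇒n≡0 (≤-trans (diametral u x) (≤-reflexive d≡0)))))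
      where d≡0 = trans (cong (dist u) (sym u≡w)) (dist-refl u)

    Triple : Fin n → Set
    Triple v = v ≡ u ⊎ v ≡ w ⊎ v ≡ x

    ¬Triple : ∀ {z} → z ≢ u → z ≢ w → z ≢ x → ¬ Triple z
    ¬Triple z≢u _ _ (inj₁ z≡u) = z≢u z≡u
    ¬Triple _ z≢w _ (inj₂ (inj₁ z≡w)) = z≢w z≡w
    ¬Triple _ _ z≢x (inj₂ (inj₂ z≡x)) = z≢x z≡x

    ≢-by-dist : ∀ (f : Fin n → ℕ) {z c} → f z < d → f c ≡ d → z ≢ c
    ≢-by-dist f fz<d fc≡d refl = <-irrefl fc≡d fz<d

    along-geodesic : ∀ a b → (∀ {z} → dist a z < d → dist z b < d → z ≢ a → z ≢ b → ¬ Triple z) → Visible G Triple a b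
    along-geodesic a b avoid = visible-via (geodesic a b) (geodesic-shortest a b) λ z z-inner →
      let (az<ab , zb<ab) = inner-shortest (geodesic a b) (geodesic-shortest a b) z-inner
          (z≢a , z≢b) = inner-shortest-≢ (geodesic a b) (geodesic-shortest a b) z-inner
      in avoid (≤-trans az<ab (diametral a b)) (≤-trans zb<ab (diametral a b)) z≢a z≢b

    off-P₀ : ∀ {z} → z ∈ʷ P₀ → z ≢ x
    off-P₀ z∈P₀ refl = x∉P₀ z∈P₀

    triple-mutualVisibility : MutualVisibility G Triple
    triple-mutualVisibility _ _ (inj₁ refl) (inj₁ refl) = visible-refl
    triple-mutualVisibility _ _ (inj₂ (inj₁ refl)) (inj₂ (inj₁ refl)) = visible-refl
    triple-mutualVisibility _ _ (inj₂ (inj₂ refl)) (inj₂ (inj₂ refl)) = visible-refl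
    triple-mutualVisibility _ _ (inj₁ refl) (inj₂ (inj₁ refl)) = visible-via P₀ P₀-shortest λ z z-inner →
      let (z≢u , z≢w) = inner-shortest-≢ P₀ P₀-shortest z-inner
      in ¬Triple z≢u z≢w (off-P₀ (inner⇒∈ P₀ z-inner))
    triple-mutualVisibility _ _ (inj₂ (inj₁ refl)) (inj₁ refl) = visible-via (reverse P₀) (reverse-shortest P₀ P₀-shortest) λ z z-inner →
      let (z≢w , z≢u) = inner-shortest-≢ (reverse P₀) (reverse-shortest P₀ P₀-shortest) z-inner
      in ¬Triple z≢u z≢w (off-P₀ (∈-reverse P₀ (inner⇒∈ (reverse P₀) z-inner)))
    triple-mutualVisibility _ _ (inj₁ refl) (inj₂ (inj₂ refl)) = along-geodesic u x λ uz<d _ z≢u z≢x →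
      ¬Triple z≢u (≢-by-dist (dist u) uz<d refl) z≢x
    triple-mutualVisibility _ _ (inj₂ (inj₂ refl)) (inj₁ refl) = along-geodesic x u λ _ zu<d z≢x z≢u →
      ¬Triple z≢u (≢-by-dist (λ v → dist v u) zu<d (dist-sym w u)) z≢x
    triple-mutualVisibility _ _ (inj₂ (inj₁ refl)) (inj₂ (inj₂ refl)) = along-geodesic w x λ wz<d _ z≢w z≢x →
      ¬Triple (≢-by-dist (dist w) wz<d (dist-sym w u)) z≢w z≢x
    triple-mutualVisibility _ _ (inj₂ (inj₂ refl)) (inj₂ (inj₁ refl)) = along-geodesic x w λ _ zw<d z≢x z≢w →
      ¬Triple (≢-by-dist (λ v → dist v w) zw<d refl) z≢w z≢x

    colouring : ∀ {k} → n ≡ suc (k + k) → MVColoring G k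
    colouring {k} n≡1+k+k = colour , classes
      where
      π-data = moveToFront u≢w (x≢u ∘ sym) (x≢w ∘ sym)
      π = proj₁ π-data
      π-injective = proj₁ (proj₂ π-data)
      πu≡0 = proj₁ (proj₂ (proj₂ π-data))
      πw≡1 = proj₁ (proj₂ (proj₂ (proj₂ π-data)))
      πx≡2 = proj₂ (proj₂ (proj₂ (proj₂ π-data)))

      0<k : 0 < k
      0<k = 3≤1+n+n⇒0<n (subst (3 ≤_) n≡1+k+k (three-distinct⇒3≤n u≢w (x≢u ∘ sym) (x≢w ∘ sym)))

      -- u, w, x sit at positions 0, 1, 2 and position j gets colour ⌊(j ∸ 1)/2⌋,
      -- so the colour classes are the positions {0, 1, 2}, {3, 4}, {5, 6}, …
      colour< : ∀ v → ⌊ pred (toℕ (π v)) /2⌋ < k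
      colour< v = ⌊pred/2⌋<n 0<k (subst (toℕ (π v) <_) n≡1+k+k (toℕ<n (π v)))

      colour : Fin n → Fin k
      colour v = fromℕ< (colour< v)

      ≤2⇒Triple : ∀ {v} → toℕ (π v) ≤ 2 → Triple v
      ≤2⇒Triple {v} ≤2 with ≤2⇒≡0⊎≡1⊎≡2 ≤2
      ... | inj₁ ≡0 = inj₁ (π-injective (toℕ-injective (trans ≡0 (sym πu≡0))))
      ... | inj₂ (inj₁ ≡1) = inj₂ (inj₁ (π-injective (toℕ-injective (trans ≡1 (sym πw≡1)))))
      ... | inj₂ (inj₂ ≡2) = inj₂ (inj₂ (π-injective (toℕ-injective (trans ≡2 (sym πx≡2)))))

      classes : ∀ i → MutualVisibility G (λ v → colour v ≡ i)
      classes zero = mutualVisibility-⊆ (λ {v} eq → ≤2⇒Triple (⌊pred/2⌋≡0⇒≤2 (fromℕ<≡⇒≡toℕ (colour< v) eq)))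
                                        triple-mutualVisibility
      classes (suc r) = atMostTwo⇒mutualVisibility (atMostTwo-⊆ (λ {v} → fromℕ<≡⇒≡toℕ (colour< v))
        (atMostTwo-preimage (toℕ ∘ π) (π-injective ∘ toℕ-injective) (⌊pred/2⌋-fibre-atMostTwo (toℕ r))))

module _ {n : ℕ} (G : Graph n) (connected : Connected G) where
  open Traversal G connected

  classically-pathLabelled : ∀ {k} → n ≡ suc (k + k) → ¬ MVColoring G k →
    ¬ ¬ ((∀ {a b} → Adj G a b → Traversed a b) × Σ (Fin n → Fin n) PathLabelling)
  classically-pathLabelled {k} n≡1+k+k ¬colouring = ¬¬-map decided (¬¬-decidable (Adj G))
    where
    v₀ : Fin n
    v₀ = subst Fin (sym n≡1+k+k) zero

    decided : (∀ x y → Dec (Adj G x y)) → (∀ {a b} → Adj G a b → Traversed a b) × Σ (Fin n → Fin n) PathLabelling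
    decided adj? with Diametral.spans? G connected adj? v₀
    ... | inj₁ spans = adj⇒traversed , labelling , labelling-isPathLabelling
      where open Diametral.Spanning G connected adj? v₀ spans
    ... | inj₂ (x , x∉P₀) = ⊥-elim (¬colouring (Diametral.OffPath.colouring G connected adj? v₀ x x∉P₀ n≡1+k+k))

  noColouring⇒isPath : ∀ {k} → n ≡ suc (k + k) → ¬ MVColoring G k → IsPath G
  noColouring⇒isPath n≡1+k+k ¬colouring with ∃-vec? n (pathLabelling? ∘ lookup)
  ... | yes (v , lab) = labelling⇒isPath lab (¬¬-map proj₁ (classically-pathLabelled n≡1+k+k ¬colouring))
  ... | no ¬lab = ⊥-elim (classically-pathLabelled n≡1+k+k ¬colouring λ (_ , f , lab) →
    ¬lab (tabulate f , pathLabelling-ext (lookup∘tabulate f) lab))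

-- Paths

module Labelled {n : ℕ} (G : Graph n) (ℓ : Fin n → ℕ) (ℓ-injective : Injective _≡_ _≡_ ℓ)
                (adj⇒consecutive : ∀ {a b} → Adj G a b → Consecutive (ℓ a) (ℓ b)) where
  open Walks G

  between⇒inner : ∀ {a b z k} (P : Walk G a b k) → ℓ a < ℓ z → ℓ z < ℓ b → Inner z P
  between⇒inner [] ℓa<ℓz ℓz<ℓa = ⊥-elim (<-asym ℓa<ℓz ℓz<ℓa)
  between⇒inner {z = z} (e ∷ P) ℓa<ℓz ℓz<ℓb
    with crossing ℓ adj⇒consecutive (ℓ z) P (consecutive-< (adj⇒consecutive e) ℓa<ℓz) ℓz<ℓb
  ... | s , _ , step , ℓs≡ℓz , _ = subst (λ v → NotLast v P) (ℓ-injective ℓs≡ℓz) (step⇒notLast P step)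

  between-invisible : ∀ {S a b z} → MutualVisibility G S → S a → S b → S z → Between (ℓ a) (ℓ z) (ℓ b) → ⊥
  between-invisible {a = a} {b} mv Sa Sb Sz (inj₁ (ℓa<ℓz , ℓz<ℓb)) with mv a b Sa Sb
  ... | _ , P , _ , avoids = inner-avoided P avoids (between⇒inner P ℓa<ℓz ℓz<ℓb) Sz
  between-invisible {a = a} {b} mv Sa Sb Sz (inj₂ (ℓb<ℓz , ℓz<ℓa)) with mv b a Sb Sa
  ... | _ , P , _ , avoids = inner-avoided P avoids (between⇒inner P ℓb<ℓz ℓz<ℓa) Sz

  mutualVisibility⇒atMostTwo : ∀ {S} → MutualVisibility G S → AtMostTwo S
  mutualVisibility⇒atMostTwo mv Sa Sb Sc a≢b a≢c b≢c
    with some-between (a≢b ∘ ℓ-injective) (a≢c ∘ ℓ-injective) (b≢c ∘ ℓ-injective)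
  ... | inj₁ a-between = between-invisible mv Sb Sc Sa a-between
  ... | inj₂ (inj₁ b-between) = between-invisible mv Sa Sc Sb b-between
  ... | inj₂ (inj₂ c-between) = between-invisible mv Sa Sb Sc c-between

  colouring⇒≤ : ∀ {m} → MVColoring G m → n ≤ m + m
  colouring⇒≤ (c , classes) = fibres-atMostTwo⇒≤ c (mutualVisibility⇒atMostTwo ∘ classes)

module PathGraph {n : ℕ} (G : Graph n) (path : IsPath G) where

  vertexAt : Fin n → Fin n
  vertexAt = Bijection.to (proj₁ path)

  position : Fin n → Fin n
  position v = proj₁ (Bijection.strictlySurjective (proj₁ path) v)

  vertexAt-position : ∀ v → vertexAt (position v) ≡ v
  vertexAt-position v = proj₂ (Bijection.strictlySurjective (proj₁ path) v)

  position-injective : Injective _≡_ _≡_ (toℕ ∘ position)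
  position-injective {a} {b} eq =
    trans (sym (vertexAt-position a)) (trans (cong vertexAt (toℕ-injective eq)) (vertexAt-position b))

  adj⇒consecutive : ∀ {a b} → Adj G a b → Consecutive (toℕ (position a)) (toℕ (position b))
  adj⇒consecutive {a} {b} e =
    proj₁ (proj₂ path (position a) (position b)) (subst₂ (Adj G) (sym (vertexAt-position a)) (sym (vertexAt-position b)) e)

  consecutive⇒adj : ∀ {a b} → Consecutive (toℕ (position a)) (toℕ (position b)) → Adj G a b
  consecutive⇒adj {a} {b} cons =
    subst₂ (Adj G) (vertexAt-position a) (vertexAt-position b) (proj₂ (proj₂ path (position a) (position b)) cons)

  adj? : ∀ a b → Dec (Adj G a b)
  adj? a b with consecutive? (toℕ (position a)) (toℕ (position b))
  ... | yes cons = yes (consecutive⇒adj cons)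
  ... | no ¬cons = no (¬cons ∘ adj⇒consecutive)

  open Labelled G (toℕ ∘ position) position-injective adj⇒consecutive public using (colouring⇒≤)

proposition5p6 : ∀ (n : ℕ) (G : Graph n) → Connected G → ∀ (χ : ℕ) → IsMVChromaticNumber G χ → ((n < χ + χ × χ ≡ ⌈ n /2⌉) ⇔ (IsPath G × OddNat n))
proposition5p6 n G connected χ (colouring , minimal) = mk⇔ to from
  where
  to : n < χ + χ × χ ≡ ⌈ n /2⌉ → IsPath G × OddNat n
  to (n<χ+χ , χ≡⌈n/2⌉) = noColouring⇒isPath G connected n≡1+k+k (λ c → <⇒≱ k<χ (minimal k c)) , odd
    where
    odd = <⌈/2⌉+⌈/2⌉⇒oddNat n (subst (λ c → n < c + c) χ≡⌈n/2⌉ n<χ+χ)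
    k = proj₁ (oddNat⇒1+n+n odd)
    n≡1+k+k = proj₂ (oddNat⇒1+n+n odd)
    open ≡-Reasoning
    k<χ : k < χ
    k<χ = ≤-reflexive (sym (begin
      χ                  ≡⟨ χ≡⌈n/2⌉ ⟩
      ⌈ n /2⌉            ≡⟨ cong ⌈_/2⌉ n≡1+k+k ⟩
      ⌈ suc (k + k) /2⌉  ≡⟨ ⌈1+n+n/2⌉≡1+n k ⟩
      suc k              ∎))
  from : IsPath G × OddNat n → n < χ + χ × χ ≡ ⌈ n /2⌉
  from (path , odd) = odd-squeeze {n = k} n≡1+k+k (colouring⇒≤ colouring) (minimal _ halvingColouring)
    where
    open PathGraph G path
    open Distance G connected adj?
    k = proj₁ (oddNat⇒1+n+n odd)
    n≡1+k+k = proj₂ (oddNat⇒1+n+n odd)
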